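{- Let $G=(V,E)$ be an atomic bispanning graph, $v$ a vertex of degree $3$ with neighbours $x,y,z$ and incident edges $e_x,e_y,e_z$, let $\{a,b,c\}=\{x,y,z\}$, let $G_{a,b}$ be $G-v$ plus a new edge $e_{a,b}$ joining $a,b$, and let $\rho=\rho_{e_{a,b},c}$. Let $(S,T)\in V_{\tau(G_{a,b})}$ and let $e,f$ be edges of $G_{a,b}$ with $e,f\neq e_{a,b}$. Then $(e,f,\rho(S,T))$ is an arc of $\vec{\tau}_3(G)$ if and only if $(e,f,S,T)$ is an arc of $\vec{\tau}_3(G_{a,b})$ and either $$e_{a,b}\in S\ \text{and}\ e\notin D_{G_{a,b}}(S,e_{a,b})\cap C_G(T+e_c,e_a)\cap C_G(T+e_c,e_b),$$ or $$e_{a,b}\in T\ \text{and}\ e\notin D_{G_{a,b}}(T,e_{a,b})\cap C_G(S+e_c,e_a)\cap C_G(S+e_c,e_b).$$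
   Context: Graphs are finite, undirected, may have parallel edges, no loops; bispanning means the edge set is the disjoint union of two spanning trees; atomic means no subgraph other than $G$ and $K_1$ is bispanning. The graphs $G_{a,b}$ are bispanning; their edge set is $E\setminus\{e_x,e_y,e_z\}$ plus $e_{a,b}$. For a bispanning $H$, $V_{\tau(H)}$ is the set of ordered pairs $(S,T)$ of disjoint spanning trees covering $E(H)$. $\rho_{e_{a,b},c}(S,T)=(S-e_{a,b}+e_a+e_b,T+e_c)$ if $e_{a,b}\in S$ and $(S+e_c,T-e_{a,b}+e_a+e_b)$ if $e_{a,b}\in T$. For a spanning tree $T$ and $e\notin T$, $C_H(T,e)$ is the unique cycle in $T+e$; for a spanning tree $S$ and $e\in S$, $D_H(S,e)$ is the set of edges joining the two components of $S-e$. $\vec{\tau}_3(H)$ has vertex set $V_{\tau(H)}$ and arcs $(e,f,S,T)$ from $(S,T)$ to $(S-e+f,T+e-f)$ when $(e,f)\in S\times T$ and $D_H(S,e)\cap C_H(T,e)=\{e,f\}$, and from $(S,T)$ to $(S+e-f,T-e+f)$ when $(e,f)\in T\times S$ and $D_H(T,e)\cap C_H(S,e)=\{e,f\}$. -}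

module Defs where

open import Data.Bool using (Bool; true; false; _∧_; _∨_; not; if_then_else_)
open import Data.Maybe using (Maybe; just; nothing)
import Data.Maybe.Properties as MaybeP
open import Data.List using (List)
open import Data.List.Membership.Propositional using (_∈_)
open import Data.Product using (Σ; ∃; _×_; _,_; proj₁; proj₂)
open import Data.Sum using (_⊎_)
open import Relation.Nullary using (¬_)
open import Relation.Nullary.Decidable using (⌊_⌋)
open import Relation.Binary.Definitions using (DecidableEquality)
open import Relation.Binary.PropositionalEquality using (_≡_; _≢_)
open import Function.Bundles using (_⇔_)

-- Parallel edges are allowed.
record Graph : Set₁ where
  field
    V E : Set
    _≟V_ : DecidableEquality V
    _≟E_ : DecidableEquality E
    src tgt : E → V
    inV : V → Bool
    inE : E → Bool

open Graph public

EdgeSet : Graph → Set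
EdgeSet G = E G → Bool

module _ (G : Graph) where
  ins : EdgeSet G → E G → EdgeSet G
  ins S e g = S g ∨ ⌊ _≟E_ G g e ⌋

  del : EdgeSet G → E G → EdgeSet G
  del S e g = S g ∧ not ⌊ _≟E_ G g e ⌋

  data Conn (F : EdgeSet G) (u : V G) : V G → Set where
    here : Conn F u u
    fwd  : ∀ {w} g → F g ≡ true → Conn F u w → src G g ≡ w → Conn F u (tgt G g)
    bwd  : ∀ {w} g → F g ≡ true → Conn F u w → tgt G g ≡ w → Conn F u (src G g)

  IsSpanningTree : EdgeSet G → Set
  IsSpanningTree T =
      (∀ g → T g ≡ true → inE G g ≡ true)
    × (∃ λ u → inV G u ≡ true)
    × (∀ u w → inV G u ≡ true → inV G w ≡ true → Conn T u w)
    × (∀ g → T g ≡ true → ¬ Conn (del T g) (src G g) (tgt G g))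

  InVτ : EdgeSet G → EdgeSet G → Set
  InVτ S T =
      IsSpanningTree S × IsSpanningTree T
    × (∀ g → ¬ (S g ≡ true × T g ≡ true))
    × (∀ g → inE G g ≡ true → S g ≡ true ⊎ T g ≡ true)

  Bispanning : Set
  Bispanning = Σ (EdgeSet G) λ S → Σ (EdgeSet G) λ T → InVτ S T

  -- g ∈ C_G(T, e): g is an edge of the (unique) cycle of T + e,
  -- i.e. g ∈ T + e and its endpoints stay connected in (T + e) - g
  Cyc : EdgeSet G → E G → E G → Set
  Cyc T e g = ins T e g ≡ true × Conn (del (ins T e) g) (src G g) (tgt G g)

  -- g ∈ D_G(S, e): g is an edge of G joining the two components of S - e
  Cut : EdgeSet G → E G → E G → Set
  Cut S e g = inE G g ≡ true × ¬ Conn (del S e) (src G g) (tgt G g)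

  IsArc : E G → E G → EdgeSet G → EdgeSet G → Set
  IsArc e f S T = InVτ S T ×
    (  (S e ≡ true × T f ≡ true × (∀ g → (Cut S e g × Cyc T e g) ⇔ (g ≡ e ⊎ g ≡ f)))
     ⊎ (T e ≡ true × S f ≡ true × (∀ g → (Cut T e g × Cyc S e g) ⇔ (g ≡ e ⊎ g ≡ f))))

module _ (G : Graph) where
  restrict : (V G → Bool) → EdgeSet G → Graph
  restrict W F = record
    { V = V G ; E = E G ; _≟V_ = _≟V_ G ; _≟E_ = _≟E_ G
    ; src = src G ; tgt = tgt G ; inV = W ; inE = F }

  IsSubgraph : (V G → Bool) → EdgeSet G → Set
  IsSubgraph W F =
      (∀ u → W u ≡ true → inV G u ≡ true)
    × (∀ g → F g ≡ true → inE G g ≡ true × W (src G g) ≡ true × W (tgt G g) ≡ true)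

  Atomic : Set
  Atomic = ∀ W F → IsSubgraph W F → Bispanning (restrict W F) →
      ((∀ u → W u ≡ inV G u) × (∀ g → F g ≡ inE G g))
    ⊎ (Σ (V G) λ u → W u ≡ true × (∀ w → W w ≡ true → w ≡ u) × (∀ g → F g ≡ false))

  Full : Set
  Full = (∀ u → inV G u ≡ true) × (∀ g → inE G g ≡ true)

  Finite : Set
  Finite = (Σ (List (V G)) λ vs → ∀ u → inV G u ≡ true → u ∈ vs)
         × (Σ (List (E G)) λ es → ∀ g → inE G g ≡ true → g ∈ es)

  NoLoops : Set
  NoLoops = ∀ g → inE G g ≡ true → src G g ≢ tgt G g

  Joins : E G → V G → V G → Set
  Joins g u w = (src G g ≡ u × tgt G g ≡ w) ⊎ (src G g ≡ w × tgt G g ≡ u)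

  incident : V G → E G → Bool
  incident v g = ⌊ _≟V_ G (src G g) v ⌋ ∨ ⌊ _≟V_ G (tgt G g) v ⌋

  -- G_{a,b}: G - v plus a new edge e_{a,b} = nothing joining a and b
  Gab : V G → V G → V G → Graph
  Gab v a b = record
    { V = V G ; E = Maybe (E G)
    ; _≟V_ = _≟V_ G ; _≟E_ = MaybeP.≡-dec (_≟E_ G)
    ; src = srcab ; tgt = tgtab
    ; inV = λ u → not ⌊ _≟V_ G u v ⌋
    ; inE = inEab }
    where
      srcab : Maybe (E G) → V G
      srcab nothing = a
      srcab (just g) = src G g
      tgtab : Maybe (E G) → V G
      tgtab nothing = b
      tgtab (just g) = tgt G g
      inEab : Maybe (E G) → Bool
      inEab nothing = true
      inEab (just g) = inE G g ∧ not (incident v g)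

  lift : (Maybe (E G) → Bool) → EdgeSet G
  lift S g = S (just g)

  ρ : E G → E G → E G → (Maybe (E G) → Bool) → (Maybe (E G) → Bool) → EdgeSet G × EdgeSet G
  ρ ea eb ec S T =
    if S nothing
    then (ins G (ins G (lift S) ea) eb , ins G (lift T) ec)
    else (ins G (lift S) ec , ins G (ins G (lift T) ea) eb)

-- ρ replaces e_{a,b} in the tree S containing it by the path a – v – b and hangs v on the
-- other tree by e_c.  Contracting e_a in S′ (resp. e_c in T′) undoes this: for an edge set of G
-- meeting v in e_a and e_b, or in a single edge, walks between vertices other than v are the
-- same as in its counterpart in G_{a,b}.  So the cut and cycle conditions defining an arc agree
-- at every edge not at v.  For e ∈ T, cut–cycle duality in S′, T′ and S expresses the conditions
-- at e_a, e_b (in G) and at e_{a,b} (in G_{a,b}) through κ = [e ∈ D(S, e_{a,b})] and the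
-- connectivity of a, b, c in T − e; as the latter is an equivalence relation, the conditions at
-- e_a and e_b together amount to the one at e_{a,b} plus the exclusion of the extra case, which
-- for e ∈ S cannot occur at all.  If e_{a,b} ∈ T, exchange S and T.

module Submission where

open import Defs
open import Data.Bool using (Bool; true; false; if_then_else_)
open import Data.Bool.Properties using (¬-not)
open import Data.Maybe using (just; nothing)
open import Data.Maybe.Properties using (just-injective)
open import Data.Product using (_×_; _,_; proj₁; proj₂)
open import Data.Product.Algebra using (×-assoc)
open import Data.Product.Function.NonDependent.Propositional using (_×-⇔_)
open import Data.Sum using (_⊎_; inj₁; inj₂; swap)
open import Data.Sum.Function.Propositional using (_⊎-⇔_)
open import Data.Empty using (⊥-elim)
open import Function.Base using (_∘_)
open import Function.Bundles using (_⇔_; mk⇔; Equivalence)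
open import Function.Construct.Composition using (_⇔-∘_)
open import Function.Construct.Identity using (⇔-id)
open import Function.Construct.Symmetry using (⇔-sym)
open import Function.Properties.Inverse using (↔⇒⇔)
open import Function.Related.Propositional using (module EquationalReasoning)
open import Function.Related.TypeIsomorphisms using (¬-cong-⇔)
open import Relation.Nullary using (¬_; Dec; yes; no)
open import Relation.Nullary.Decidable using (⌊_⌋)
open import Relation.Binary.PropositionalEquality using (_≡_; _≢_; refl; sym; trans; subst₂; ≢-sym)

-- Edge sets, walks and spanning trees

module EdgeSetProperties (K : Graph) where

  ins⁻ : ∀ F e g → ins K F e g ≡ true → F g ≡ true ⊎ g ≡ e
  ins⁻ F e g p with F g | _≟E_ K g e
  ... | true  | _     = inj₁ refl
  ... | false | yes q = inj₂ q

  ins⁺ : ∀ F e g → F g ≡ true → ins K F e g ≡ true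
  ins⁺ F e g p rewrite p = refl

  ins-self : ∀ F e → ins K F e e ≡ true
  ins-self F e with F e | _≟E_ K e e
  ... | true  | _     = refl
  ... | false | yes _ = refl
  ... | false | no q  = ⊥-elim (q refl)

  ins-≢ : ∀ F e g → g ≢ e → ins K F e g ≡ F g
  ins-≢ F e g g≢e with F g | _≟E_ K g e
  ... | true  | _     = refl
  ... | false | yes q = ⊥-elim (g≢e q)
  ... | false | no _  = refl

  del⁻ : ∀ F e g → del K F e g ≡ true → F g ≡ true × g ≢ e
  del⁻ F e g p with F g | _≟E_ K g e
  ... | true | no q = refl , q

  del⁺ : ∀ F e g → F g ≡ true → g ≢ e → del K F e g ≡ true
  del⁺ F e g p g≢e with F g | _≟E_ K g e
  ... | true | no _  = refl
  ... | true | yes q = ⊥-elim (g≢e q)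

  del-self : ∀ F e → del K F e e ≡ false
  del-self F e with F e | _≟E_ K e e
  ... | false | _     = refl
  ... | true  | yes _ = refl
  ... | true  | no q  = ⊥-elim (q refl)

  del-≢ : ∀ F e g → g ≢ e → del K F e g ≡ F g
  del-≢ F e g g≢e with F g | _≟E_ K g e
  ... | false | _     = refl
  ... | true  | no _  = refl
  ... | true  | yes q = ⊥-elim (g≢e q)

module WalkProperties (K : Graph) where

  open EdgeSetProperties K

  edge : ∀ {F} g → F g ≡ true → Conn K F (src K g) (tgt K g)
  edge g p = fwd g p here refl

  edge˘ : ∀ {F} g → F g ≡ true → Conn K F (tgt K g) (src K g)
  edge˘ g p = bwd g p here refl

  Conn-trans : ∀ {F u w x} → Conn K F u w → Conn K F w x → Conn K F u x
  Conn-trans c here = c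
  Conn-trans c (fwd g p d eq) = fwd g p (Conn-trans c d) eq
  Conn-trans c (bwd g p d eq) = bwd g p (Conn-trans c d) eq

  Conn-sym : ∀ {F u w} → Conn K F u w → Conn K F w u
  Conn-sym here = here
  Conn-sym (fwd g p c refl) = Conn-trans (edge˘ g p) (Conn-sym c)
  Conn-sym (bwd g p c refl) = Conn-trans (edge g p) (Conn-sym c)

  Conn-mono : ∀ {F F′ u w} → (∀ g → F g ≡ true → F′ g ≡ true) → Conn K F u w → Conn K F′ u w
  Conn-mono sub here = here
  Conn-mono sub (fwd g p c eq) = fwd g (sub g p) (Conn-mono sub c) eq
  Conn-mono sub (bwd g p c eq) = bwd g (sub g p) (Conn-mono sub c) eq

  Joins⇒Conn : ∀ {F g u w} → Joins K g u w → F g ≡ true → Conn K F u w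
  Joins⇒Conn {g = g} (inj₁ (refl , refl)) p = edge g p
  Joins⇒Conn {g = g} (inj₂ (refl , refl)) p = edge˘ g p

  Conn-Joins : ∀ {F g u w} → Joins K g u w → Conn K F (src K g) (tgt K g) ⇔ Conn K F u w
  Conn-Joins (inj₁ (refl , refl)) = mk⇔ (λ c → c) (λ c → c)
  Conn-Joins (inj₂ (refl , refl)) = mk⇔ Conn-sym Conn-sym

  Conn-resp-start : ∀ {F u u′ x} → Conn K F u u′ → Conn K F u x ⇔ Conn K F u′ x
  Conn-resp-start c = mk⇔ (Conn-trans (Conn-sym c)) (Conn-trans c)

  -- Cut the walk at its last traversal of e.
  Conn-del-split : ∀ F e {w} → Conn K F (src K e) w →
    Conn K (del K F e) (src K e) w ⊎ Conn K (del K F e) (tgt K e) w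
  Conn-del-split F e here = inj₁ here
  Conn-del-split F e (fwd g p c eq) with _≟E_ K g e
  ... | yes refl = inj₂ here
  ... | no g≢e with Conn-del-split F e c
  ...   | inj₁ d = inj₁ (fwd g (del⁺ F e g p g≢e) d eq)
  ...   | inj₂ d = inj₂ (fwd g (del⁺ F e g p g≢e) d eq)
  Conn-del-split F e (bwd g p c eq) with _≟E_ K g e
  ... | yes refl = inj₁ here
  ... | no g≢e with Conn-del-split F e c
  ...   | inj₁ d = inj₁ (bwd g (del⁺ F e g p g≢e) d eq)
  ...   | inj₂ d = inj₂ (bwd g (del⁺ F e g p g≢e) d eq)

  Conn-invariant : ∀ {A : Set} {F u w} (σ : V K → A) →
    (∀ g → F g ≡ true → σ (src K g) ≡ σ (tgt K g)) → Conn K F u w → σ u ≡ σ w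
  Conn-invariant σ inv here = refl
  Conn-invariant σ inv (fwd g p c refl) = trans (Conn-invariant σ inv c) (inv g p)
  Conn-invariant σ inv (bwd g p c refl) = trans (Conn-invariant σ inv c) (sym (inv g p))

Conn-map : (K L : Graph) (φ : V K → V L) {F : EdgeSet K} {F′ : EdgeSet L} →
  (∀ g → F g ≡ true → Conn L F′ (φ (src K g)) (φ (tgt K g))) →
  ∀ {u w} → Conn K F u w → Conn L F′ (φ u) (φ w)
Conn-map K L φ step here = here
Conn-map K L φ step (fwd g p c refl) = Conn-trans (Conn-map K L φ step c) (step g p)
  where open WalkProperties L
Conn-map K L φ step (bwd g p c refl) = Conn-trans (Conn-map K L φ step c) (Conn-sym (step g p))
  where open WalkProperties L


module SpanningTreeProperties (K : Graph) where

  open EdgeSetProperties K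
  open WalkProperties K

  tree-connected : ∀ {T} → IsSpanningTree K T →
    ∀ {u w} → inV K u ≡ true → inV K w ≡ true → Conn K T u w
  tree-connected (_ , _ , connected , _) = connected _ _

  tree-acyclic : ∀ {T} → IsSpanningTree K T → ∀ g → T g ≡ true → ¬ Conn K (del K T g) (src K g) (tgt K g)
  tree-acyclic (_ , _ , _ , acyclic) = acyclic

  cut⇔cycle : ∀ {S n g} → IsSpanningTree K S → S n ≡ true → g ≢ n → inE K g ≡ true →
    inV K (src K n) ≡ true → inV K (src K g) ≡ true → inV K (tgt K g) ≡ true →
    Cut K S n g ⇔ Cyc K S g n
  cut⇔cycle {S} {n} {g} (_ , _ , connected , acyclic) n∈S g≢n g∈E n-in g-src g-tgt =
    mk⇔ (λ (_ , cut) → ins⁺ S g n n∈S , through-g cut (split g-src) (split g-tgt))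
        (λ (_ , cycle) → g∈E , λ g-bypass → acyclic n n∈S (Conn-map K K (λ x → x) (bypass g-bypass) cycle))
    where
    S-n : EdgeSet K
    S-n = del K S n
    S+g-n : EdgeSet K
    S+g-n = del K (ins K S g) n

    split : ∀ {x} → inV K x ≡ true → Conn K S-n (src K n) x ⊎ Conn K S-n (tgt K n) x
    split x-in = Conn-del-split S n (connected _ _ n-in x-in)

    widen : ∀ {x y} → Conn K S-n x y → Conn K S+g-n x y
    widen = Conn-mono λ h d →
      del⁺ (ins K S g) n h (ins⁺ S g h (proj₁ (del⁻ S n h d))) (proj₂ (del⁻ S n h d))

    g∈S+g-n : S+g-n g ≡ true
    g∈S+g-n = del⁺ (ins K S g) n g (ins-self S g) g≢n

    through-g : ¬ Conn K S-n (src K g) (tgt K g) →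
      Conn K S-n (src K n) (src K g) ⊎ Conn K S-n (tgt K n) (src K g) →
      Conn K S-n (src K n) (tgt K g) ⊎ Conn K S-n (tgt K n) (tgt K g) →
      Conn K S+g-n (src K n) (tgt K n)
    through-g cut (inj₁ p) (inj₁ q) = ⊥-elim (cut (Conn-trans (Conn-sym p) q))
    through-g cut (inj₂ p) (inj₂ q) = ⊥-elim (cut (Conn-trans (Conn-sym p) q))
    through-g cut (inj₁ p) (inj₂ q) =
      Conn-trans (widen p) (Conn-trans (edge g g∈S+g-n) (Conn-sym (widen q)))
    through-g cut (inj₂ p) (inj₁ q) =
      Conn-trans (widen q) (Conn-trans (edge˘ g g∈S+g-n) (Conn-sym (widen p)))

    bypass : Conn K S-n (src K g) (tgt K g) →
      ∀ h → S+g-n h ≡ true → Conn K S-n (src K h) (tgt K h)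
    bypass g-bypass h d with del⁻ (ins K S g) n h d
    ... | h∈S+g , h≢n with ins⁻ S g h h∈S+g
    ...   | inj₁ h∈S = edge h (del⁺ S n h h∈S h≢n)
    ...   | inj₂ refl = g-bypass

true⇒≢false : ∀ {b} → b ≡ true → b ≢ false
true⇒≢false refl ()

Exactly : {A : Set} → (A → Set) → A → A → Set
Exactly Q e f = ∀ g → Q g ⇔ (g ≡ e ⊎ g ≡ f)

three-point : ∀ {A : Set} {R : A → A → Set} →
  (∀ {x y} → R x y → R y x) → (∀ {x y z} → R x y → R y z → R x z) →
  ∀ {κ : Set} c a b →
  (¬ (¬ R c a × κ) × ¬ (¬ R c b × κ)) ⇔ (¬ (¬ R a b × κ) × ¬ (κ × ¬ R c a × ¬ R c b))
three-point R-sym R-trans c a b = mk⇔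
  (λ (¬ca , ¬cb) →
       (λ (¬ab , k) → ¬ca ((λ ca → ¬cb ((λ cb → ¬ab (R-trans (R-sym ca) cb)) , k)) , k))
     , (λ (k , ¬Rca , _) → ¬ca (¬Rca , k)))
  (λ (¬ab , ¬all) →
       (λ (¬Rca , k) → ¬ab ((λ ab → ¬all (k , ¬Rca , λ cb → ¬Rca (R-trans cb (R-sym ab)))) , k))
     , (λ (¬Rcb , k) → ¬ab ((λ ab → ¬all (k , (λ ca → ¬Rcb (R-trans ca ab)) , ¬Rcb)) , k)))

InVτ-swap : ∀ K {S T} → InVτ K S T → InVτ K T S
InVτ-swap K (S-tree , T-tree , disjoint , cover) =
  T-tree , S-tree , (λ g (p , q) → disjoint g (q , p)) , (λ g g∈E → swap (cover g g∈E))

IsArc-swap : ∀ K {e f S T} → IsArc K e f S T ⇔ IsArc K e f T S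
IsArc-swap K = mk⇔ (λ (vτ , arc) → InVτ-swap K vτ , swap arc) (λ (vτ , arc) → InVτ-swap K vτ , swap arc)

select-left : ∀ {P Q C R : Set} → P → ¬ Q → ((P × C) ⊎ (Q × R)) ⇔ C
select-left p ¬q =
  mk⇔ (λ { (inj₁ (_ , c)) → c ; (inj₂ (q , _)) → ⊥-elim (¬q q) }) (λ c → inj₁ (p , c))

select-right : ∀ {P Q C R : Set} → ¬ P → Q → ((P × R) ⊎ (Q × C)) ⇔ C
select-right ¬p q =
  mk⇔ (λ { (inj₁ (p , _)) → ⊥-elim (¬p p) ; (inj₂ (_ , c)) → c }) (λ c → inj₂ (q , c))

module DegreeThreeSplit
  (G : Graph) (full : Full G) (loopless : NoLoops G)
  (v a b c : V G) (ea eb ec : E G)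
  (ea≢eb : ea ≢ eb) (eb≢ec : eb ≢ ec) (ea≢ec : ea ≢ ec)
  (ea-joins : Joins G ea v a) (eb-joins : Joins G eb v b) (ec-joins : Joins G ec v c)
  (degree-3 : ∀ g → incident G v g ≡ true → g ≡ ea ⊎ g ≡ eb ⊎ g ≡ ec)
  where

  H : Graph
  H = Gab G v a b

  module 𝔾 where
    open EdgeSetProperties G public
    open WalkProperties G public
    open SpanningTreeProperties G public

  module ℍ where
    open EdgeSetProperties H public
    open WalkProperties H public
    open SpanningTreeProperties H public

  -- The old edges are those of G − v; in G_{a,b} they are the edges just g.
  Old Incident : E G → Set
  Old g = incident G v g ≡ false
  Incident g = incident G v g ≡ true

  Old⇒≢ : ∀ {g h} → Old g → Incident h → g ≢ h
  Old⇒≢ old inc refl = true⇒≢false inc old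

  Old⇒src≢v : ∀ {g} → Old g → src G g ≢ v
  Old⇒src≢v {g} old src≡v with _≟V_ G (src G g) v
  ... | yes _ = true⇒≢false refl old
  ... | no src≢v = src≢v src≡v

  Old⇒tgt≢v : ∀ {g} → Old g → tgt G g ≢ v
  Old⇒tgt≢v {g} old tgt≡v with _≟V_ G (src G g) v | _≟V_ G (tgt G g) v
  ... | yes _ | _      = true⇒≢false refl old
  ... | no _  | yes _  = true⇒≢false refl old
  ... | no _  | no tgt≢v = tgt≢v tgt≡v

  Joins-v⇒Incident : ∀ {g p} → Joins G g v p → Incident g
  Joins-v⇒Incident {g} (inj₁ (src≡v , _)) with _≟V_ G (src G g) v
  ... | yes _ = refl
  ... | no src≢v = ⊥-elim (src≢v src≡v)
  Joins-v⇒Incident {g} (inj₂ (_ , tgt≡v)) with _≟V_ G (src G g) v | _≟V_ G (tgt G g) v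
  ... | yes _ | _ = refl
  ... | no _  | yes _ = refl
  ... | no _  | no tgt≢v = ⊥-elim (tgt≢v tgt≡v)

  Joins-v⇒≢v : ∀ {g p} → Joins G g v p → p ≢ v
  Joins-v⇒≢v {g} (inj₁ (s , t)) refl = loopless g (proj₂ full g) (trans s (sym t))
  Joins-v⇒≢v {g} (inj₂ (s , t)) refl = loopless g (proj₂ full g) (trans s (sym t))

  a≢v : a ≢ v
  a≢v = Joins-v⇒≢v ea-joins

  b≢v : b ≢ v
  b≢v = Joins-v⇒≢v eb-joins

  c≢v : c ≢ v
  c≢v = Joins-v⇒≢v ec-joins

  ea-incident : Incident ea
  ea-incident = Joins-v⇒Incident ea-joins

  eb-incident : Incident eb
  eb-incident = Joins-v⇒Incident eb-joins

  ec-incident : Incident ec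
  ec-incident = Joins-v⇒Incident ec-joins

  inV-H : ∀ {x} → x ≢ v → inV H x ≡ true
  inV-H {x} x≢v with _≟V_ G x v
  ... | yes x≡v = ⊥-elim (x≢v x≡v)
  ... | no _ = refl

  inE-H⇒Old : ∀ g → inE H (just g) ≡ true → Old g
  inE-H⇒Old g p with incident G v g | inE G g | p
  ... | false | _     | _  = refl
  ... | true  | true  | ()
  ... | true  | false | ()

  Old⇒inE-H : ∀ {g} → Old g → inE H (just g) ≡ true
  Old⇒inE-H {g} old rewrite old | proj₂ full g = refl

  -- Contraction at v

  at-v : V G → Bool
  at-v x = ⌊ _≟V_ G x v ⌋

  at-v-v : at-v v ≡ true
  at-v-v with _≟V_ G v v
  ... | yes _ = refl
  ... | no v≢v = ⊥-elim (v≢v refl)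

  at-v-≢v : ∀ {x} → x ≢ v → at-v x ≡ false
  at-v-≢v {x} x≢v with _≟V_ G x v
  ... | yes x≡v = ⊥-elim (x≢v x≡v)
  ... | no _ = refl

  at-v⇒≡v : ∀ {x} → at-v x ≡ true → x ≡ v
  at-v⇒≡v {x} p with _≟V_ G x v
  ... | yes x≡v = x≡v

  collapse : V G → V G → V G
  collapse p x = if at-v x then p else x

  collapse-v : ∀ p → collapse p v ≡ p
  collapse-v p rewrite at-v-v = refl

  collapse-≢v : ∀ p {x} → x ≢ v → collapse p x ≡ x
  collapse-≢v p x≢v rewrite at-v-≢v x≢v = refl

  collapse-Joins : ∀ {F₂ h p q} → Joins G h v q → Conn H F₂ p q →
    Conn H F₂ (collapse p (src G h)) (collapse p (tgt G h))
  collapse-Joins {p = p} j@(inj₁ (refl , refl)) c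
    rewrite collapse-v p | collapse-≢v p (Joins-v⇒≢v j) = c
  collapse-Joins {p = p} j@(inj₂ (refl , refl)) c
    rewrite collapse-v p | collapse-≢v p (Joins-v⇒≢v j) = ℍ.Conn-sym c

  Conn-contract : ∀ p {F : EdgeSet G} {F₂ : EdgeSet H} →
    (∀ h → Old h → F h ≡ true → F₂ (just h) ≡ true) →
    (∀ h → Incident h → F h ≡ true → Conn H F₂ (collapse p (src G h)) (collapse p (tgt G h))) →
    ∀ {x y} → x ≢ v → y ≢ v → Conn G F x y → Conn H F₂ x y
  Conn-contract p {F} {F₂} old-step incident-step x≢v y≢v c =
    subst₂ (Conn H F₂) (collapse-≢v p x≢v) (collapse-≢v p y≢v) (Conn-map G H (collapse p) step c)
    where
    step : ∀ h → F h ≡ true → Conn H F₂ (collapse p (src G h)) (collapse p (tgt G h))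
    step h h∈F with incident G v h in eq
    ... | true = incident-step h eq h∈F
    ... | false rewrite collapse-≢v p (Old⇒src≢v eq) | collapse-≢v p (Old⇒tgt≢v eq) =
      ℍ.edge (just h) (old-step h eq h∈F)

  Conn-expand : ∀ {F₂ : EdgeSet H} {F : EdgeSet G} →
    (∀ h → F₂ (just h) ≡ true → F h ≡ true) → (F₂ nothing ≡ true → Conn G F a b) →
    ∀ {x y} → Conn H F₂ x y → Conn G F x y
  Conn-expand {F₂} {F} old-step new-step = Conn-map H G (λ x → x) step
    where
    step : ∀ h → F₂ h ≡ true → Conn G F (src H h) (tgt H h)
    step (just h) p = 𝔾.edge h (old-step h p)
    step nothing p = new-step p

  record OldAgree (F : EdgeSet G) (F₂ : EdgeSet H) : Set where
    field
      same-old : ∀ h → Old h → F h ≡ F₂ (just h)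
      only-old : ∀ h → F₂ (just h) ≡ true → Old h

    old-step : ∀ h → Old h → F h ≡ true → F₂ (just h) ≡ true
    old-step h old p = trans (sym (same-old h old)) p

    old-step˘ : ∀ h → F₂ (just h) ≡ true → F h ≡ true
    old-step˘ h p = trans (same-old h (only-old h p)) p

    incident-absent : ∀ {h} → Incident h → F₂ (just h) ≡ false
    incident-absent inc = ¬-not λ p → true⇒≢false inc (only-old _ p)

  open OldAgree

  agree-ins : ∀ {F F₂ e} → Old e → OldAgree F F₂ → OldAgree (ins G F e) (ins H F₂ (just e))
  agree-ins {F} {F₂} {e} e-old agree = record { same-old = same ; only-old = only }
    where
    same : ∀ h → Old h → ins G F e h ≡ ins H F₂ (just e) (just h)
    same h old = by-cases (_≟E_ G h e)
      where
      by-cases : Dec (h ≡ e) → ins G F e h ≡ ins H F₂ (just e) (just h)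
      by-cases (yes refl) = trans (𝔾.ins-self F h) (sym (ℍ.ins-self F₂ (just h)))
      by-cases (no h≢e) = trans (𝔾.ins-≢ F e h h≢e)
        (trans (same-old agree h old) (sym (ℍ.ins-≢ F₂ (just e) (just h) (h≢e ∘ just-injective))))
    only : ∀ h → ins H F₂ (just e) (just h) ≡ true → Old h
    only h p with ℍ.ins⁻ F₂ (just e) (just h) p
    ... | inj₁ q = only-old agree h q
    ... | inj₂ refl = e-old

  agree-del : ∀ {F F₂} g → OldAgree F F₂ → OldAgree (del G F g) (del H F₂ (just g))
  agree-del {F} {F₂} g agree = record { same-old = same ; only-old = only }
    where
    same : ∀ h → Old h → del G F g h ≡ del H F₂ (just g) (just h)
    same h old = by-cases (_≟E_ G h g)
      where
      by-cases : Dec (h ≡ g) → del G F g h ≡ del H F₂ (just g) (just h)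
      by-cases (yes refl) = trans (𝔾.del-self F h) (sym (ℍ.del-self F₂ (just h)))
      by-cases (no h≢g) = trans (𝔾.del-≢ F g h h≢g)
        (trans (same-old agree h old) (sym (ℍ.del-≢ F₂ (just g) (just h) (h≢g ∘ just-injective))))
    only : ∀ h → del H F₂ (just g) (just h) ≡ true → Old h
    only h p = only-old agree h (proj₁ (ℍ.del⁻ F₂ (just g) (just h) p))

  agree-del-incident : ∀ {F F₂ g} → Incident g → OldAgree F F₂ → OldAgree (del G F g) (del H F₂ nothing)
  agree-del-incident {F} {F₂} {g} inc agree = record { same-old = same ; only-old = only }
    where
    same : ∀ h → Old h → del G F g h ≡ del H F₂ nothing (just h)
    same h old = trans (𝔾.del-≢ F g h (Old⇒≢ old inc))
                   (trans (same-old agree h old) (sym (ℍ.del-≢ F₂ nothing (just h) λ ())))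
    only : ∀ h → del H F₂ nothing (just h) ≡ true → Old h
    only h p = only-old agree h (proj₁ (ℍ.del⁻ F₂ nothing (just h) p))

  Transfers : EdgeSet G → EdgeSet H → Set
  Transfers F F₂ = ∀ {x y} → x ≢ v → y ≢ v → Conn G F x y ⇔ Conn H F₂ x y

  record Pendant (h₀ : E G) (F : EdgeSet G) (F₂ : EdgeSet H) : Set where
    field
      agree : OldAgree F F₂
      only-h₀ : ∀ h → Incident h → F h ≡ true → h ≡ h₀
      new-absent : F₂ nothing ≡ false

  record Spliced (F : EdgeSet G) (F₂ : EdgeSet H) : Set where
    field
      agree : OldAgree F F₂
      ea∈F : F ea ≡ true
      eb∈F : F eb ≡ true
      ec∉F : F ec ≡ false
      new∈F₂ : F₂ nothing ≡ true

  -- The pendant edge h₀ contracts to a loop at q₀.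
  Conn-pendant : ∀ {h₀ q₀ F F₂} → Joins G h₀ v q₀ → Pendant h₀ F F₂ → Transfers F F₂
  Conn-pendant {h₀} {q₀} {F} {F₂} h₀-joins pendant x≢v y≢v =
    mk⇔ (Conn-contract q₀ (old-step agree) incident-step x≢v y≢v)
        (Conn-expand (old-step˘ agree) λ p → ⊥-elim (true⇒≢false p new-absent))
    where
    open Pendant pendant
    incident-step : ∀ h → Incident h → F h ≡ true →
      Conn H F₂ (collapse q₀ (src G h)) (collapse q₀ (tgt G h))
    incident-step h inc p with only-h₀ h inc p
    ... | refl = collapse-Joins h₀-joins here

  -- Contracting ea identifies v with a, and eb becomes the new edge from a to b.
  Conn-spliced : ∀ {F F₂} → Spliced F F₂ → Transfers F F₂
  Conn-spliced {F} {F₂} spliced x≢v y≢v =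
    mk⇔ (Conn-contract a (old-step agree) incident-step x≢v y≢v)
        (Conn-expand (old-step˘ agree) λ _ →
          𝔾.Conn-trans (𝔾.Conn-sym (𝔾.Joins⇒Conn ea-joins ea∈F)) (𝔾.Joins⇒Conn eb-joins eb∈F))
    where
    open Spliced spliced
    incident-step : ∀ h → Incident h → F h ≡ true →
      Conn H F₂ (collapse a (src G h)) (collapse a (tgt G h))
    incident-step h inc p with degree-3 h inc
    ... | inj₁ refl = collapse-Joins ea-joins here
    ... | inj₂ (inj₁ refl) = collapse-Joins eb-joins (ℍ.edge nothing new∈F₂)
    ... | inj₂ (inj₂ refl) = ⊥-elim (true⇒≢false p ec∉F)

  Conn-pendant-from-v : ∀ {h₀ q₀ F F₂ x} → Joins G h₀ v q₀ → Pendant h₀ F F₂ → F h₀ ≡ true →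
    x ≢ v → Conn G F v x ⇔ Conn H F₂ q₀ x
  Conn-pendant-from-v {h₀} {q₀} {F} {F₂} {x} h₀-joins pendant h₀∈F x≢v = begin
    Conn G F v x   ∼⟨ 𝔾.Conn-resp-start (𝔾.Joins⇒Conn h₀-joins h₀∈F) ⟩
    Conn G F q₀ x  ∼⟨ Conn-pendant h₀-joins pendant (Joins-v⇒≢v h₀-joins) x≢v ⟩
    Conn H F₂ q₀ x ∎
    where open EquationalReasoning

  Pendant-ins : ∀ {h₀ F F₂ e} → Old e → Pendant h₀ F F₂ → Pendant h₀ (ins G F e) (ins H F₂ (just e))
  Pendant-ins {h₀} {F} {F₂} {e} e-old pendant = record
    { agree = agree-ins e-old agree
    ; only-h₀ = only
    ; new-absent = trans (ℍ.ins-≢ F₂ (just e) nothing λ ()) new-absent }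
    where
    open Pendant pendant
    only : ∀ h → Incident h → ins G F e h ≡ true → h ≡ h₀
    only h inc p with 𝔾.ins⁻ F e h p
    ... | inj₁ q = only-h₀ h inc q
    ... | inj₂ refl = ⊥-elim (Old⇒≢ e-old inc refl)

  Pendant-del : ∀ {h₀ F F₂} g → Pendant h₀ F F₂ → Pendant h₀ (del G F g) (del H F₂ (just g))
  Pendant-del {h₀} {F} {F₂} g pendant = record
    { agree = agree-del g agree
    ; only-h₀ = λ h inc p → only-h₀ h inc (proj₁ (𝔾.del⁻ F g h p))
    ; new-absent = trans (ℍ.del-≢ F₂ (just g) nothing λ ()) new-absent }
    where open Pendant pendant

  Spliced-ins : ∀ {F F₂ e} → Old e → Spliced F F₂ → Spliced (ins G F e) (ins H F₂ (just e))
  Spliced-ins {F} {F₂} {e} e-old spliced = record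
    { agree = agree-ins e-old agree
    ; ea∈F = 𝔾.ins⁺ F e ea ea∈F
    ; eb∈F = 𝔾.ins⁺ F e eb eb∈F
    ; ec∉F = trans (𝔾.ins-≢ F e ec (≢-sym (Old⇒≢ e-old ec-incident))) ec∉F
    ; new∈F₂ = ℍ.ins⁺ F₂ (just e) nothing new∈F₂ }
    where open Spliced spliced

  Spliced-del : ∀ {F F₂ g} → Old g → Spliced F F₂ → Spliced (del G F g) (del H F₂ (just g))
  Spliced-del {F} {F₂} {g} g-old spliced = record
    { agree = agree-del g agree
    ; ea∈F = 𝔾.del⁺ F g ea ea∈F (≢-sym (Old⇒≢ g-old ea-incident))
    ; eb∈F = 𝔾.del⁺ F g eb eb∈F (≢-sym (Old⇒≢ g-old eb-incident))
    ; ec∉F = trans (𝔾.del-≢ F g ec (≢-sym (Old⇒≢ g-old ec-incident))) ec∉F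
    ; new∈F₂ = ℍ.del⁺ F₂ (just g) nothing new∈F₂ λ () }
    where open Spliced spliced

  Cut-transfer : ∀ {F F₂ n n₂ g} → Old g → Transfers (del G F n) (del H F₂ n₂) →
    Cut G F n g ⇔ Cut H F₂ n₂ (just g)
  Cut-transfer {g = g} g-old transfers =
    mk⇔ (λ (_ , cut) → Old⇒inE-H g-old , cut ∘ Equivalence.from conn)
        (λ (_ , cut) → proj₂ full g , cut ∘ Equivalence.to conn)
    where conn = transfers (Old⇒src≢v g-old) (Old⇒tgt≢v g-old)

  Cyc-transfer : ∀ {F F₂ e g} → Old e → Old g → OldAgree F F₂ →
    Transfers (del G (ins G F e) g) (del H (ins H F₂ (just e)) (just g)) →
    Cyc G F e g ⇔ Cyc H F₂ (just e) (just g)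
  Cyc-transfer {g = g} e-old g-old agree transfers =
    mk⇔ (λ (g∈F+e , cycle) → trans (sym same) g∈F+e , Equivalence.to conn cycle)
        (λ (g∈F+e , cycle) → trans same g∈F+e , Equivalence.from conn cycle)
    where
    same = same-old (agree-ins e-old agree) g g-old
    conn = transfers (Old⇒src≢v g-old) (Old⇒tgt≢v g-old)

  Conn-isolated : ∀ {F x} → (∀ h → F h ≡ true → Old h) → Conn G F v x → x ≡ v
  Conn-isolated {F} {x} only-old c = at-v⇒≡v (trans (sym (𝔾.Conn-invariant at-v step c)) at-v-v)
    where
    step : ∀ h → F h ≡ true → at-v (src G h) ≡ at-v (tgt G h)
    step h p = trans (at-v-≢v (Old⇒src≢v (only-old h p))) (sym (at-v-≢v (Old⇒tgt≢v (only-old h p))))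

  ExactlyOld : (E G → Set) → E G → E G → Set
  ExactlyOld Q e f = ∀ g → Old g → Q g ⇔ (g ≡ e ⊎ g ≡ f)

  ExactlyOld-cong : ∀ {Q Q′ e f} → (∀ {g} → Old g → Q g ⇔ Q′ g) →
    ExactlyOld Q e f ⇔ ExactlyOld Q′ e f
  ExactlyOld-cong Q⇔Q′ = mk⇔
    (λ ex g old → ex g old ⇔-∘ ⇔-sym (Q⇔Q′ old))
    (λ ex g old → ex g old ⇔-∘ Q⇔Q′ old)

  Exactly-G : ∀ {Q e f} → Old e → Old f →
    Exactly Q e f ⇔ (ExactlyOld Q e f × (∀ g → Incident g → ¬ Q g))
  Exactly-G {Q} {e} {f} e-old f-old =
    mk⇔ (λ ex → (λ g _ → ex g) , (λ g inc q → ≢e,f inc (Equivalence.to (ex g) q))) from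
    where
    ≢e,f : ∀ {g} → Incident g → ¬ (g ≡ e ⊎ g ≡ f)
    ≢e,f inc (inj₁ refl) = true⇒≢false inc e-old
    ≢e,f inc (inj₂ refl) = true⇒≢false inc f-old
    from : ExactlyOld Q e f × (∀ g → Incident g → ¬ Q g) → Exactly Q e f
    from (old-part , incident-part) g with incident G v g in eq
    ... | true = mk⇔ (⊥-elim ∘ incident-part g eq) (⊥-elim ∘ ≢e,f eq)
    ... | false = old-part g eq

  Exactly-H : ∀ {Q : E H → Set} {e f} → Old e → Old f → (∀ g → Q (just g) → Old g) →
    Exactly Q (just e) (just f) ⇔ (ExactlyOld (Q ∘ just) e f × ¬ Q nothing)
  Exactly-H {Q} {e} {f} e-old f-old Q-old =
    mk⇔ (λ ex → (λ g _ → just-⇔ ⇔-∘ ex (just g)) , (λ q → nothing≢ (Equivalence.to (ex nothing) q)))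
        from
    where
    just-⇔ : ∀ {g} → (just g ≡ just e ⊎ just g ≡ just f) ⇔ (g ≡ e ⊎ g ≡ f)
    just-⇔ = just-≡-⇔ ⊎-⇔ just-≡-⇔
      where
      just-≡-⇔ : ∀ {g h : E G} → (just g ≡ just h) ⇔ (g ≡ h)
      just-≡-⇔ = mk⇔ just-injective (λ { refl → refl })
    nothing≢ : ¬ (nothing ≡ just e ⊎ nothing ≡ just f)
    nothing≢ (inj₁ ())
    nothing≢ (inj₂ ())
    old-of : ∀ {g} → g ≡ e ⊎ g ≡ f → Old g
    old-of (inj₁ refl) = e-old
    old-of (inj₂ refl) = f-old
    from : ExactlyOld (Q ∘ just) e f × ¬ Q nothing → Exactly Q (just e) (just f)
    from (old-part , ¬new) nothing = mk⇔ (⊥-elim ∘ ¬new) (⊥-elim ∘ nothing≢)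
    from (old-part , ¬new) (just g) = mk⇔
      (λ q → Equivalence.from just-⇔ (Equivalence.to (old-part g (Q-old g q)) q))
      (λ r → let g∈e,f = Equivalence.to just-⇔ r in Equivalence.from (old-part g (old-of g∈e,f)) g∈e,f)

  new∉S⇒new∈T : ∀ {S T} → InVτ H S T → S nothing ≡ false → T nothing ≡ true
  new∉S⇒new∈T (_ , _ , _ , cover) new∉S with cover nothing refl
  ... | inj₁ new∈S = ⊥-elim (true⇒≢false new∈S new∉S)
  ... | inj₂ new∈T = new∈T

  -- The trees of ρ(S, T)

  module ρ-Image (S T : EdgeSet H) (S,T∈Vτ : InVτ H S T) (new∈S : S nothing ≡ true) where

    S-tree : IsSpanningTree H S
    S-tree = proj₁ S,T∈Vτ

    T-tree : IsSpanningTree H T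
    T-tree = proj₁ (proj₂ S,T∈Vτ)

    S-T-disjoint : ∀ g → ¬ (S g ≡ true × T g ≡ true)
    S-T-disjoint = proj₁ (proj₂ (proj₂ S,T∈Vτ))

    S-T-cover : ∀ g → inE H g ≡ true → S g ≡ true ⊎ T g ≡ true
    S-T-cover = proj₂ (proj₂ (proj₂ S,T∈Vτ))

    new∉T : T nothing ≡ false
    new∉T = ¬-not λ p → S-T-disjoint nothing (new∈S , p)

    S′ T′ : EdgeSet G
    S′ = ins G (ins G (lift G S) ea) eb
    T′ = ins G (lift G T) ec

    S′-agree : OldAgree S′ S
    S′-agree = record
      { same-old = λ h old → trans (𝔾.ins-≢ (ins G (lift G S) ea) eb h (Old⇒≢ old eb-incident))
                                   (𝔾.ins-≢ (lift G S) ea h (Old⇒≢ old ea-incident))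
      ; only-old = λ h p → inE-H⇒Old h (proj₁ S-tree (just h) p) }

    T′-agree : OldAgree T′ T
    T′-agree = record
      { same-old = λ h old → 𝔾.ins-≢ (lift G T) ec h (Old⇒≢ old ec-incident)
      ; only-old = λ h p → inE-H⇒Old h (proj₁ T-tree (just h) p) }

    S′-members : ∀ h → S′ h ≡ true → S (just h) ≡ true ⊎ h ≡ ea ⊎ h ≡ eb
    S′-members h p with 𝔾.ins⁻ (ins G (lift G S) ea) eb h p
    ... | inj₂ h≡eb = inj₂ (inj₂ h≡eb)
    ... | inj₁ q with 𝔾.ins⁻ (lift G S) ea h q
    ...   | inj₁ r = inj₁ r
    ...   | inj₂ h≡ea = inj₂ (inj₁ h≡ea)

    T′-members : ∀ h → T′ h ≡ true → T (just h) ≡ true ⊎ h ≡ ec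
    T′-members h p = 𝔾.ins⁻ (lift G T) ec h p

    ea∈S′ : S′ ea ≡ true
    ea∈S′ = 𝔾.ins⁺ (ins G (lift G S) ea) eb ea (𝔾.ins-self (lift G S) ea)

    eb∈S′ : S′ eb ≡ true
    eb∈S′ = 𝔾.ins-self (ins G (lift G S) ea) eb

    ec∈T′ : T′ ec ≡ true
    ec∈T′ = 𝔾.ins-self (lift G T) ec

    ec∉S′ : S′ ec ≡ false
    ec∉S′ = trans (𝔾.ins-≢ (ins G (lift G S) ea) eb ec (≢-sym eb≢ec))
              (trans (𝔾.ins-≢ (lift G S) ea ec (≢-sym ea≢ec)) (incident-absent S′-agree ec-incident))

    T′-incident : ∀ {h} → Incident h → T′ h ≡ true → h ≡ ec
    T′-incident {h} inc p with T′-members h p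
    ... | inj₁ q = ⊥-elim (true⇒≢false q (incident-absent T′-agree inc))
    ... | inj₂ h≡ec = h≡ec

    S′-incident : ∀ {h} → Incident h → S′ h ≡ true → h ≡ ea ⊎ h ≡ eb
    S′-incident {h} inc p with S′-members h p
    ... | inj₁ q = ⊥-elim (true⇒≢false q (incident-absent S′-agree inc))
    ... | inj₂ h≡ea∨eb = h≡ea∨eb

    S′-spliced : Spliced S′ S
    S′-spliced = record
      { agree = S′-agree ; ea∈F = ea∈S′ ; eb∈F = eb∈S′ ; ec∉F = ec∉S′ ; new∈F₂ = new∈S }

    T′-pendant : Pendant ec T′ T
    T′-pendant = record
      { agree = T′-agree ; only-h₀ = λ h inc → T′-incident inc ; new-absent = new∉T }

    S′-ea-pendant : Pendant eb (del G S′ ea) (del H S nothing)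
    S′-ea-pendant = record
      { agree = agree-del-incident ea-incident S′-agree
      ; only-h₀ = only
      ; new-absent = ℍ.del-self S nothing }
      where
      only : ∀ h → Incident h → del G S′ ea h ≡ true → h ≡ eb
      only h inc p with 𝔾.del⁻ S′ ea h p
      ... | h∈S′ , h≢ea with S′-incident inc h∈S′
      ...   | inj₁ h≡ea = ⊥-elim (h≢ea h≡ea)
      ...   | inj₂ h≡eb = h≡eb

    S′-eb-pendant : Pendant ea (del G S′ eb) (del H S nothing)
    S′-eb-pendant = record
      { agree = agree-del-incident eb-incident S′-agree
      ; only-h₀ = only
      ; new-absent = ℍ.del-self S nothing }
      where
      only : ∀ h → Incident h → del G S′ eb h ≡ true → h ≡ ea
      only h inc p with 𝔾.del⁻ S′ eb h p
      ... | h∈S′ , h≢eb with S′-incident inc h∈S′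
      ...   | inj₁ h≡ea = h≡ea
      ...   | inj₂ h≡eb = ⊥-elim (h≢eb h≡eb)

    eb∈S′-ea : del G S′ ea eb ≡ true
    eb∈S′-ea = 𝔾.del⁺ S′ ea eb eb∈S′ (≢-sym ea≢eb)

    ea∈S′-eb : del G S′ eb ea ≡ true
    ea∈S′-eb = 𝔾.del⁺ S′ eb ea ea∈S′ ea≢eb

    new-acyclic : ¬ Conn H (del H S nothing) a b
    new-acyclic = ℍ.tree-acyclic S-tree nothing new∈S

    S′-tree : IsSpanningTree G S′
    S′-tree = (λ g _ → proj₂ full g) , (a , proj₁ full a)
            , (λ u w _ _ → 𝔾.Conn-trans (𝔾.Conn-sym (from-a u)) (from-a w)) , acyclic
      where
      from-a : ∀ u → Conn G S′ a u
      from-a u with _≟V_ G u v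
      ... | yes refl = 𝔾.Conn-sym (𝔾.Joins⇒Conn ea-joins ea∈S′)
      ... | no u≢v = Equivalence.from (Conn-spliced S′-spliced a≢v u≢v)
                       (ℍ.tree-connected S-tree (inV-H a≢v) (inV-H u≢v))
      acyclic : ∀ g → S′ g ≡ true → ¬ Conn G (del G S′ g) (src G g) (tgt G g)
      acyclic g p c with S′-members g p
      ... | inj₁ q = ℍ.tree-acyclic S-tree (just g) q
            (Equivalence.to (Conn-spliced (Spliced-del g-old S′-spliced) (Old⇒src≢v g-old) (Old⇒tgt≢v g-old))
              c)
        where g-old = only-old S′-agree g q
      ... | inj₂ (inj₁ refl) = new-acyclic (ℍ.Conn-sym
            (Equivalence.to (Conn-pendant-from-v eb-joins S′-ea-pendant eb∈S′-ea a≢v)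
              (Equivalence.to (𝔾.Conn-Joins ea-joins) c)))
      ... | inj₂ (inj₂ refl) = new-acyclic
            (Equivalence.to (Conn-pendant-from-v ea-joins S′-eb-pendant ea∈S′-eb b≢v)
              (Equivalence.to (𝔾.Conn-Joins eb-joins) c))

    T′-tree : IsSpanningTree G T′
    T′-tree = (λ g _ → proj₂ full g) , (c , proj₁ full c)
            , (λ u w _ _ → 𝔾.Conn-trans (𝔾.Conn-sym (from-c u)) (from-c w)) , acyclic
      where
      from-c : ∀ u → Conn G T′ c u
      from-c u with _≟V_ G u v
      ... | yes refl = 𝔾.Conn-sym (𝔾.Joins⇒Conn ec-joins ec∈T′)
      ... | no u≢v = Equivalence.from (Conn-pendant ec-joins T′-pendant c≢v u≢v)
                       (ℍ.tree-connected T-tree (inV-H c≢v) (inV-H u≢v))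
      T′-ec-old : ∀ h → del G T′ ec h ≡ true → Old h
      T′-ec-old h p with 𝔾.del⁻ T′ ec h p
      ... | h∈T′ , h≢ec with T′-members h h∈T′
      ...   | inj₁ q = only-old T′-agree h q
      ...   | inj₂ h≡ec = ⊥-elim (h≢ec h≡ec)
      acyclic : ∀ g → T′ g ≡ true → ¬ Conn G (del G T′ g) (src G g) (tgt G g)
      acyclic g p cycle with T′-members g p
      ... | inj₁ q = ℍ.tree-acyclic T-tree (just g) q
            (Equivalence.to (Conn-pendant ec-joins (Pendant-del g T′-pendant) (Old⇒src≢v g-old) (Old⇒tgt≢v g-old))
              cycle)
        where g-old = only-old T′-agree g q
      ... | inj₂ refl = c≢v (Conn-isolated T′-ec-old (Equivalence.to (𝔾.Conn-Joins ec-joins) cycle))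

    S′,T′∈Vτ : InVτ G S′ T′
    S′,T′∈Vτ = S′-tree , T′-tree , disjoint , cover
      where
      disjoint : ∀ g → ¬ (S′ g ≡ true × T′ g ≡ true)
      disjoint g (p , q) with T′-members g q
      ... | inj₁ r = S-T-disjoint (just g) (old-step S′-agree g (only-old T′-agree g r) p , r)
      ... | inj₂ refl = true⇒≢false p ec∉S′
      cover : ∀ g → inE G g ≡ true → S′ g ≡ true ⊎ T′ g ≡ true
      cover g _ with incident G v g in eq
      ... | true with degree-3 g eq
      ...   | inj₁ refl = inj₁ ea∈S′
      ...   | inj₂ (inj₁ refl) = inj₁ eb∈S′
      ...   | inj₂ (inj₂ refl) = inj₂ ec∈T′
      cover g _ | false with S-T-cover (just g) (Old⇒inE-H eq)
      ...   | inj₁ r = inj₁ (old-step˘ S′-agree g r)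
      ...   | inj₂ r = inj₂ (old-step˘ T′-agree g r)

    module AtEdge (e : E G) (e-old : Old e) where

      Cut-S′ : ∀ {g} → Old g → Cut G S′ e g ⇔ Cut H S (just e) (just g)
      Cut-S′ g-old = Cut-transfer g-old (Conn-spliced (Spliced-del e-old S′-spliced))

      Cyc-S′ : ∀ {g} → Old g → Cyc G S′ e g ⇔ Cyc H S (just e) (just g)
      Cyc-S′ g-old = Cyc-transfer e-old g-old S′-agree
        (Conn-spliced (Spliced-del g-old (Spliced-ins e-old S′-spliced)))

      Cut-T′ : ∀ {g} → Old g → Cut G T′ e g ⇔ Cut H T (just e) (just g)
      Cut-T′ g-old = Cut-transfer g-old (Conn-pendant ec-joins (Pendant-del e T′-pendant))

      Cyc-T′ : ∀ {g} → Old g → Cyc G T′ e g ⇔ Cyc H T (just e) (just g)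
      Cyc-T′ {g} g-old = Cyc-transfer e-old g-old T′-agree
        (Conn-pendant ec-joins (Pendant-del g (Pendant-ins e-old T′-pendant)))

      new-cut⇔cycle : Cut H S nothing (just e) ⇔ Cyc H S (just e) nothing
      new-cut⇔cycle = ℍ.cut⇔cycle S-tree new∈S (λ ()) (Old⇒inE-H e-old)
        (inV-H a≢v) (inV-H (Old⇒src≢v e-old)) (inV-H (Old⇒tgt≢v e-old))

      Cyc-S′-incident : ∀ {h₀ h₁ q₁} → S′ h₀ ≡ true → Incident h₀ →
        Joins G h₁ v q₁ → Pendant h₁ (del G S′ h₀) (del H S nothing) →
        Cyc G S′ e h₀ ⇔ Cut H S nothing (just e)
      Cyc-S′-incident {h₀} h₀∈S′ inc h₁-joins pendant = begin
        Cyc G S′ e h₀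
          ∼⟨ ⇔-sym (𝔾.cut⇔cycle S′-tree h₀∈S′ (Old⇒≢ e-old inc) (proj₂ full e)
                      (proj₁ full (src G h₀)) (proj₁ full (src G e)) (proj₁ full (tgt G e))) ⟩
        Cut G S′ h₀ e
          ∼⟨ Cut-transfer e-old (Conn-pendant h₁-joins pendant) ⟩
        Cut H S nothing (just e) ∎
        where open EquationalReasoning

      Cyc-S′-ea : Cyc G S′ e ea ⇔ Cut H S nothing (just e)
      Cyc-S′-ea = Cyc-S′-incident ea∈S′ ea-incident eb-joins S′-ea-pendant

      Cyc-S′-eb : Cyc G S′ e eb ⇔ Cut H S nothing (just e)
      Cyc-S′-eb = Cyc-S′-incident eb∈S′ eb-incident ea-joins S′-eb-pendant

      Cut-T′-incident : ∀ {h q} → Joins G h v q → Cut G T′ e h ⇔ (¬ Conn H (del H T (just e)) c q)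
      Cut-T′-incident {h} {q} h-joins =
        mk⇔ (λ (_ , cut) → cut ∘ Equivalence.from conn) (λ cut → proj₂ full h , cut ∘ Equivalence.to conn)
        where
        open EquationalReasoning
        ec∈T′-e : del G T′ e ec ≡ true
        ec∈T′-e = 𝔾.del⁺ T′ e ec ec∈T′ (≢-sym (Old⇒≢ e-old ec-incident))
        conn : Conn G (del G T′ e) (src G h) (tgt G h) ⇔ Conn H (del H T (just e)) c q
        conn = begin
          Conn G (del G T′ e) (src G h) (tgt G h)
            ∼⟨ 𝔾.Conn-Joins h-joins ⟩
          Conn G (del G T′ e) v q
            ∼⟨ Conn-pendant-from-v ec-joins (Pendant-del e T′-pendant) ec∈T′-e (Joins-v⇒≢v h-joins) ⟩
          Conn H (del H T (just e)) c q ∎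

      Cyc-T′-through-e : ∀ {h q} → T (just e) ≡ true → Joins G h v q →
        Cyc G T′ h e ⇔ (¬ Conn H (del H T (just e)) c q)
      Cyc-T′-through-e {h} e∈T h-joins = begin
        Cyc G T′ h e
          ∼⟨ ⇔-sym (𝔾.cut⇔cycle T′-tree (old-step˘ T′-agree e e∈T)
                      (≢-sym (Old⇒≢ e-old (Joins-v⇒Incident h-joins)))
                      (proj₂ full h) (proj₁ full (src G e)) (proj₁ full (src G h)) (proj₁ full (tgt G h))) ⟩
        Cut G T′ e h
          ∼⟨ Cut-T′-incident h-joins ⟩
        (¬ Conn H (del H T (just e)) c _) ∎
        where open EquationalReasoning

      ¬Cyc-S′-ec : ¬ Cyc G S′ e ec
      ¬Cyc-S′-ec (p , _) with 𝔾.ins⁻ S′ e ec p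
      ... | inj₁ q = true⇒≢false q ec∉S′
      ... | inj₂ ec≡e = Old⇒≢ e-old ec-incident (sym ec≡e)

      ¬Cyc-T′-incident : ∀ {h} → Incident h → ¬ Cyc G T′ e h
      ¬Cyc-T′-incident {h} inc (p , cycle) with 𝔾.ins⁻ T′ e h p
      ... | inj₂ h≡e = Old⇒≢ e-old inc (sym h≡e)
      ... | inj₁ q with T′-incident inc q
      ...   | refl = c≢v (Conn-isolated T′+e-ec-old (Equivalence.to (𝔾.Conn-Joins ec-joins) cycle))
        where
        T′+e-ec-old : ∀ h′ → del G (ins G T′ e) ec h′ ≡ true → Old h′
        T′+e-ec-old h′ d with 𝔾.del⁻ (ins G T′ e) ec h′ d
        ... | h′∈T′+e , h′≢ec with 𝔾.ins⁻ T′ e h′ h′∈T′+e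
        ...   | inj₂ refl = e-old
        ...   | inj₁ r with T′-members h′ r
        ...     | inj₁ s = only-old T′-agree h′ s
        ...     | inj₂ h′≡ec = ⊥-elim (h′≢ec h′≡ec)

      ¬Cyc-T-new : ¬ Cyc H T (just e) nothing
      ¬Cyc-T-new (p , _) with ℍ.ins⁻ T (just e) nothing p
      ... | inj₁ q = true⇒≢false q new∉T

    module Arc (e f : E G) (e-old : Old e) (f-old : Old f) where

      open AtEdge e e-old
      open EquationalReasoning

      S-arc-G T-arc-G : E G → Set
      S-arc-G g = Cut G S′ e g × Cyc G T′ e g
      T-arc-G g = Cut G T′ e g × Cyc G S′ e g

      S-arc-H T-arc-H : E H → Set
      S-arc-H g = Cut H S (just e) g × Cyc H T (just e) g
      T-arc-H g = Cut H T (just e) g × Cyc H S (just e) g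

      Extra : Set
      Extra = Cut H S nothing (just e) × Cyc G T′ ea e × Cyc G T′ eb e

      R : V G → V G → Set
      R = Conn H (del H T (just e))

      κ : Set
      κ = Cut H S nothing (just e)

      Cut-T-new : Cut H T (just e) nothing ⇔ (¬ R a b)
      Cut-T-new = mk⇔ proj₂ (refl ,_)

      S-side : Exactly S-arc-G e f ⇔ Exactly S-arc-H (just e) (just f)
      S-side = begin
        Exactly S-arc-G e f
          ∼⟨ Exactly-G e-old f-old ⟩
        (ExactlyOld S-arc-G e f × (∀ g → Incident g → ¬ S-arc-G g))
          ∼⟨ ExactlyOld-cong (λ g-old → Cut-S′ g-old ×-⇔ Cyc-T′ g-old)
             ×-⇔ mk⇔ (λ _ → ¬Cyc-T-new ∘ proj₂) (λ _ g inc → ¬Cyc-T′-incident inc ∘ proj₂) ⟩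
        (ExactlyOld (S-arc-H ∘ just) e f × ¬ S-arc-H nothing)
          ∼⟨ ⇔-sym (Exactly-H e-old f-old λ g → inE-H⇒Old g ∘ proj₁ ∘ proj₁) ⟩
        Exactly S-arc-H (just e) (just f) ∎

      incident-part : T (just e) ≡ true →
        (∀ g → Incident g → ¬ T-arc-G g) ⇔ (¬ T-arc-H nothing × ¬ Extra)
      incident-part e∈T = begin
        (∀ g → Incident g → ¬ T-arc-G g)
          ∼⟨ mk⇔ (λ none → none ea ea-incident ∘ Equivalence.from at-ea
                         , none eb eb-incident ∘ Equivalence.from at-eb)
                 (λ (¬ea , ¬eb) g inc → by-degree-3 ¬ea ¬eb g (degree-3 g inc)) ⟩
        (¬ (¬ R c a × κ) × ¬ (¬ R c b × κ))
          ∼⟨ three-point ℍ.Conn-sym ℍ.Conn-trans c a b ⟩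
        (¬ (¬ R a b × κ) × ¬ (κ × ¬ R c a × ¬ R c b))
          ∼⟨ ¬-cong-⇔ (⇔-sym (Cut-T-new ×-⇔ ⇔-sym new-cut⇔cycle))
             ×-⇔ ¬-cong-⇔ (⇔-sym (⇔-id κ ×-⇔ Cyc-T′-through-e e∈T ea-joins
                                         ×-⇔ Cyc-T′-through-e e∈T eb-joins)) ⟩
        (¬ T-arc-H nothing × ¬ Extra) ∎
        where
        at-ea : T-arc-G ea ⇔ (¬ R c a × κ)
        at-ea = Cut-T′-incident ea-joins ×-⇔ Cyc-S′-ea
        at-eb : T-arc-G eb ⇔ (¬ R c b × κ)
        at-eb = Cut-T′-incident eb-joins ×-⇔ Cyc-S′-eb
        by-degree-3 : ¬ (¬ R c a × κ) → ¬ (¬ R c b × κ) → ∀ g → g ≡ ea ⊎ g ≡ eb ⊎ g ≡ ec → ¬ T-arc-G g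
        by-degree-3 ¬ea ¬eb g (inj₁ refl) = ¬ea ∘ Equivalence.to at-ea
        by-degree-3 ¬ea ¬eb g (inj₂ (inj₁ refl)) = ¬eb ∘ Equivalence.to at-eb
        by-degree-3 ¬ea ¬eb g (inj₂ (inj₂ refl)) = ¬Cyc-S′-ec ∘ proj₂

      T-side : T (just e) ≡ true → Exactly T-arc-G e f ⇔ (Exactly T-arc-H (just e) (just f) × ¬ Extra)
      T-side e∈T = begin
        Exactly T-arc-G e f
          ∼⟨ Exactly-G e-old f-old ⟩
        (ExactlyOld T-arc-G e f × (∀ g → Incident g → ¬ T-arc-G g))
          ∼⟨ ExactlyOld-cong (λ g-old → Cut-T′ g-old ×-⇔ Cyc-S′ g-old) ×-⇔ incident-part e∈T ⟩
        (ExactlyOld (T-arc-H ∘ just) e f × (¬ T-arc-H nothing × ¬ Extra))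
          ∼⟨ ⇔-sym (↔⇒⇔ (×-assoc _ _ _ _)) ⟩
        ((ExactlyOld (T-arc-H ∘ just) e f × ¬ T-arc-H nothing) × ¬ Extra)
          ∼⟨ ⇔-sym (Exactly-H e-old f-old λ g → inE-H⇒Old g ∘ proj₁ ∘ proj₁) ×-⇔ ⇔-id (¬ Extra) ⟩
        (Exactly T-arc-H (just e) (just f) × ¬ Extra) ∎

      e∈S⇒¬Extra : S (just e) ≡ true → ¬ Extra
      e∈S⇒¬Extra e∈S (_ , (e∈T′+ea , _) , _) with 𝔾.ins⁻ T′ ea e e∈T′+ea
      ... | inj₁ e∈T′ = S-T-disjoint (just e) (e∈S , old-step T′-agree e e-old e∈T′)
      ... | inj₂ e≡ea = Old⇒≢ e-old ea-incident e≡ea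

      arc⇔ : IsArc G e f S′ T′ ⇔ (IsArc H (just e) (just f) S T × ¬ Extra)
      arc⇔ = mk⇔ to from
        where
        S′≡S : ∀ {g} → Old g → S′ g ≡ S (just g)
        S′≡S = same-old S′-agree _
        T′≡T : ∀ {g} → Old g → T′ g ≡ T (just g)
        T′≡T = same-old T′-agree _
        to : IsArc G e f S′ T′ → IsArc H (just e) (just f) S T × ¬ Extra
        to (_ , inj₁ (e∈S′ , f∈T′ , exactly)) =
          (S,T∈Vτ , inj₁ (e∈S , trans (sym (T′≡T f-old)) f∈T′ , Equivalence.to S-side exactly))
          , e∈S⇒¬Extra e∈S
          where e∈S = trans (sym (S′≡S e-old)) e∈S′
        to (_ , inj₂ (e∈T′ , f∈S′ , exactly)) =
          (S,T∈Vτ , inj₂ (e∈T , trans (sym (S′≡S f-old)) f∈S′ , proj₁ H-side)) , proj₂ H-side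
          where
          e∈T = trans (sym (T′≡T e-old)) e∈T′
          H-side = Equivalence.to (T-side e∈T) exactly
        from : IsArc H (just e) (just f) S T × ¬ Extra → IsArc G e f S′ T′
        from ((_ , inj₁ (e∈S , f∈T , exactly)) , _) =
          S′,T′∈Vτ , inj₁ (trans (S′≡S e-old) e∈S , trans (T′≡T f-old) f∈T , Equivalence.from S-side exactly)
        from ((_ , inj₂ (e∈T , f∈S , exactly)) , ¬extra) =
          S′,T′∈Vτ , inj₂ (trans (T′≡T e-old) e∈T , trans (S′≡S f-old) f∈S
                          , Equivalence.from (T-side e∈T) (exactly , ¬extra))

mainTheorem18 : (G : Graph) → Full G → Finite G → NoLoops G → Bispanning G → Atomic G →
    (v a b c : V G) (ea eb ec : E G) →
    ea ≢ eb → eb ≢ ec → ea ≢ ec →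
    Joins G ea v a → Joins G eb v b → Joins G ec v c →
    (∀ g → incident G v g ≡ true → g ≡ ea ⊎ g ≡ eb ⊎ g ≡ ec) →
    (S T : EdgeSet (Gab G v a b)) → InVτ (Gab G v a b) S T →
    (e f : E G) → inE (Gab G v a b) (just e) ≡ true → inE (Gab G v a b) (just f) ≡ true →
    IsArc G e f (proj₁ (ρ G ea eb ec S T)) (proj₂ (ρ G ea eb ec S T))
    ⇔ (IsArc (Gab G v a b) (just e) (just f) S T
       × ((S nothing ≡ true
           × ¬ (Cut (Gab G v a b) S nothing (just e)
                × Cyc G (ins G (lift G T) ec) ea e
                × Cyc G (ins G (lift G T) ec) eb e))
         ⊎ (T nothing ≡ true
           × ¬ (Cut (Gab G v a b) T nothing (just e)
                × Cyc G (ins G (lift G S) ec) ea e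
                × Cyc G (ins G (lift G S) ec) eb e))))
mainTheorem18 G full _ loopless _ _ v a b c ea eb ec ea≢eb eb≢ec ea≢ec ea-joins eb-joins ec-joins degree-3
              S T S,T∈Vτ e f e∈H f∈H
  with S nothing in S-new
... | true = (⇔-id _ ×-⇔ ⇔-sym (select-left refl λ new∈T → true⇒≢false new∈T new∉T)) ⇔-∘ arc⇔
  where
  open DegreeThreeSplit G full loopless v a b c ea eb ec ea≢eb eb≢ec ea≢ec ea-joins eb-joins ec-joins degree-3
  open ρ-Image S T S,T∈Vτ S-new using (new∉T)
  open ρ-Image.Arc S T S,T∈Vτ S-new e f (inE-H⇒Old e e∈H) (inE-H⇒Old f f∈H)
... | false =
  (⇔-id _ ×-⇔ ⇔-sym (select-right (λ ()) new∈T))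
    ⇔-∘ ((IsArc-swap H ×-⇔ ⇔-id _) ⇔-∘ (arc⇔ ⇔-∘ IsArc-swap G))
  where
  open DegreeThreeSplit G full loopless v a b c ea eb ec ea≢eb eb≢ec ea≢ec ea-joins eb-joins ec-joins degree-3
  new∈T : T nothing ≡ true
  new∈T = new∉S⇒new∈T S,T∈Vτ S-new
  open ρ-Image.Arc T S (InVτ-swap H S,T∈Vτ) new∈T e f (inE-H⇒Old e e∈H) (inE-H⇒Old f f∈H)
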